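{- Let $\mathcal{H}$ be a family of Hoffman graphs and let $G$ be a slim $\mathcal{H}$-line graph having a strict $\mathcal{H}$-cover $\mathfrak{n}$. Suppose that (1) $\mathrm{Aut}^*(\mathfrak{n})=\{\mathrm{id}_{V(\mathfrak{n})}\}$; (2) $|\mathrm{Aut}(\mathfrak{n})|=|\mathrm{Aut}(G)|$; and (3) every strict $\mathcal{H}$-cover of $G$ is isomorphic to $\mathfrak{n}$. Then $G$ has a unique strict $\mathcal{H}$-cover up to equivalence.
   Context: A Hoffman graph $\mathfrak{h}=(H,\mu)$ is a finite simple graph $H$ with labeling $\mu:V(H)\to\{f,s\}$ such that every fat vertex (label $f$) has a slim neighbour (label $s$), and fat vertices are pairwise non-adjacent. $V_s,V_f$ denote slim/fat vertex sets, $N^f_{\mathfrak{h}}(x)$ fat neighbours of $x$. A Hoffman subgraph is an induced subgraph with restricted labeling; isomorphisms/automorphisms are label-preserving; membership in families is up to isomorphism. Ordinary graphs are Hoffman graphs without fat vertices. $\mathrm{Aut}^*(\mathfrak{h})=\{\psi\in\mathrm{Aut}(\mathfrak{h}):\psi|_{V_s(\mathfrak{h})}=\mathrm{id}\}$. Sum: $\mathfrak{h}=\bigoplus_i\mathfrak{h}^i$ (Hoffman subgraphs) means (i) $V(\mathfrak{h})=\bigcup V(\mathfrak{h}^i)$; (ii) $V_s(\mathfrak{h})$ is the disjoint union of the $V_s(\mathfrak{h}^i)$; (iii) $N^f_{\mathfrak{h}^i}(x)=N^f_{\mathfrak{h}}(x)$ for $x\in V_s(\mathfrak{h}^i)$;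 (iv) for slim $x\in\mathfrak{h}^i$, $y\in\mathfrak{h}^j$, $i\ne j$: $|N^f_{\mathfrak{h}}(x)\cap N^f_{\mathfrak{h}}(y)|\le1$ with equality iff $x,y$ adjacent. $\mathfrak{g}$ is an $\mathcal{H}$-line Hoffman graph if it is a Hoffman subgraph of some sum $\mathfrak{h}$ of members of $\mathcal{H}$ (an $\mathcal{H}$-cover; strict if $V_s(\mathfrak{h})=V_s(\mathfrak{g})$); a slim $\mathcal{H}$-line graph is such a $\mathfrak{g}$ without fat vertices. Strict covers $\mathfrak{h},\mathfrak{h}'$ of $\mathfrak{g}$ are equivalent if some isomorphism $\mathfrak{h}\to\mathfrak{h}'$ restricts to the identity on $V(\mathfrak{g})$. -}

module Defs where

open import Data.Nat using (ℕ; zero; suc; _+_; _≤_)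
open import Data.Bool using (Bool; true; false; if_then_else_; _∧_)
import Data.Bool.Properties as BoolP
open import Data.Fin using (Fin; zero; suc)
import Data.Fin.Properties as FinP
open import Data.Vec using (Vec; []; _∷_; lookup)
open import Data.List using (List; []; _∷_; length; filter; map; concatMap; allFin)
open import Data.Product using (Σ; ∃; _×_; _,_)
open import Relation.Binary.PropositionalEquality using (_≡_)
open import Relation.Nullary using (¬_; Dec)
open import Relation.Nullary.Decidable using (_×-dec_; _→-dec_)
open import Function using (_∘_)

count : ∀ {n} → (Fin n → Bool) → ℕ
count {zero}  p = 0
count {suc n} p = (if p zero then 1 else 0) + count (p ∘ suc)

record HoffmanGraph : Set where
  field
    n          : ℕ
    adj        : Fin n → Fin n → Bool
    fat        : Fin n → Bool
    adj-sym    : ∀ x y → adj x y ≡ adj y x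
    adj-irrefl : ∀ x → adj x x ≡ false
    fat-indep  : ∀ x y → fat x ≡ true → fat y ≡ true → adj x y ≡ false
    fat-slim   : ∀ x → fat x ≡ true →
                 ∃ λ y → fat y ≡ false × adj x y ≡ true

open HoffmanGraph public

V : HoffmanGraph → Set
V h = Fin (n h)

Slim : (h : HoffmanGraph) → V h → Set
Slim h x = fat h x ≡ false

-- g is (isomorphic to) a Hoffman subgraph of h: a label-preserving
-- injective map V g → V h that preserves and reflects adjacency
-- (i.e. an isomorphism of g onto an induced Hoffman subgraph of h).
record Embedding (g h : HoffmanGraph) : Set where
  field
    emb       : V g → V h
    emb-inj   : ∀ x y → emb x ≡ emb y → x ≡ y
    emb-adj   : ∀ x y → adj h (emb x) (emb y) ≡ adj g x y
    emb-fat   : ∀ x → fat h (emb x) ≡ fat g x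

open Embedding public

record Iso (g h : HoffmanGraph) : Set where
  field
    iso       : V g → V h
    iso-inj   : ∀ x y → iso x ≡ iso y → x ≡ y
    iso-surj  : ∀ y → ∃ λ x → iso x ≡ y
    iso-adj   : ∀ x y → adj h (iso x) (iso y) ≡ adj g x y
    iso-fat   : ∀ x → fat h (iso x) ≡ fat g x

open Iso public

_≅_ : HoffmanGraph → HoffmanGraph → Set
g ≅ h = Iso g h

_∈ᴴ_ : HoffmanGraph → (HoffmanGraph → Set) → Set
h ∈ᴴ ℋ = ∃ λ h' → ℋ h' × (h ≅ h')

IsAut : (h : HoffmanGraph) → (V h → V h) → Set
IsAut h f = (∀ x y → f x ≡ f y → x ≡ y)
          × (∀ y → ∃ λ x → f x ≡ y)
          × (∀ x y → adj h (f x) (f y) ≡ adj h x y)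
          × (∀ x → fat h (f x) ≡ fat h x)

isAut? : (h : HoffmanGraph) → (f : V h → V h) → Dec (IsAut h f)
isAut? h f =
  FinP.all? (λ x → FinP.all? (λ y → (f x FinP.≟ f y) →-dec (x FinP.≟ y)))
  ×-dec FinP.all? (λ y → FinP.any? (λ x → f x FinP.≟ y))
  ×-dec FinP.all? (λ x → FinP.all? (λ y → adj h (f x) (f y) BoolP.≟ adj h x y))
  ×-dec FinP.all? (λ x → fat h (f x) BoolP.≟ fat h x)

-- All vectors of length k with entries from a list (= all functions
-- Fin k → A with values in the list, via lookup).
allVecs : ∀ {A : Set} (k : ℕ) → List A → List (Vec A k)
allVecs zero    xs = [] ∷ []
allVecs (suc k) xs = concatMap (λ a → map (a ∷_) (allVecs k xs)) xs

-- |Aut(h)| : number of maps V h → V h (each listed exactly once, as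
-- the vector of its values) that are automorphisms.
|Aut| : HoffmanGraph → ℕ
|Aut| h = length (filter (λ v → isAut? h (lookup v)) (allVecs (n h) (allFin (n h))))

commonFat : (h : HoffmanGraph) → V h → V h → ℕ
commonFat h x y = count (λ z → fat h z ∧ (adj h x z ∧ adj h y z))

record SumOf (ℋ : HoffmanGraph → Set) (h : HoffmanGraph) : Set₁ where
  field
    k      : ℕ
    comp   : Fin k → HoffmanGraph
    incl   : (i : Fin k) → Embedding (comp i) h
    inℋ    : (i : Fin k) → comp i ∈ᴴ ℋ
    cover  : ∀ v → ∃ λ i → ∃ λ x → emb (incl i) x ≡ v
    slim-disj : ∀ i j (x : V (comp i)) (y : V (comp j)) →
                Slim (comp i) x → Slim (comp j) y →
                emb (incl i) x ≡ emb (incl j) y → i ≡ j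
    fatNbrs : ∀ i (x : V (comp i)) → Slim (comp i) x →
              ∀ z → fat h z ≡ true → adj h (emb (incl i) x) z ≡ true →
              ∃ λ w → emb (incl i) w ≡ z
    common≤1 : ∀ i j → ¬ (i ≡ j) → (x : V (comp i)) (y : V (comp j)) →
               Slim (comp i) x → Slim (comp j) y →
               commonFat h (emb (incl i) x) (emb (incl j) y) ≤ 1
    common≡1 : ∀ i j → ¬ (i ≡ j) → (x : V (comp i)) (y : V (comp j)) →
               Slim (comp i) x → Slim (comp j) y →
               (commonFat h (emb (incl i) x) (emb (incl j) y) ≡ 1 →
                  adj h (emb (incl i) x) (emb (incl j) y) ≡ true)
               × (adj h (emb (incl i) x) (emb (incl j) y) ≡ true →
                  commonFat h (emb (incl i) x) (emb (incl j) y) ≡ 1)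

record StrictCover (ℋ : HoffmanGraph → Set) (g : HoffmanGraph) : Set₁ where
  field
    cov      : HoffmanGraph
    cov-sum  : SumOf ℋ cov
    cov-emb  : Embedding g cov
    cov-strict : ∀ v → Slim cov v → ∃ λ x → emb cov-emb x ≡ v

open StrictCover public

Equivalent : ∀ {ℋ g} → StrictCover ℋ g → StrictCover ℋ g → Set
Equivalent c c' = Σ (Iso (cov c) (cov c')) λ φ →
  ∀ x → iso φ (emb (cov-emb c) x) ≡ emb (cov-emb c') x

AutStarTrivial : HoffmanGraph → Set
AutStarTrivial h = ∀ ψ → IsAut h ψ → (∀ x → Slim h x → ψ x ≡ x) → ∀ x → ψ x ≡ x

IsSlimGraph : HoffmanGraph → Set
IsSlimGraph g = ∀ x → fat g x ≡ false

-- Let 𝔫 be a strict ℋ-cover of a slim graph G.  As G has no fat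
-- vertices and 𝔫 is strict, the slim vertices of a strict cover are
-- exactly the copy of G, so every isomorphism between strict covers
-- induces an automorphism of G; in particular restriction is a map
-- Aut(𝔫) → Aut(G).  If Aut*(𝔫) is trivial this map is injective, and
-- if |Aut(𝔫)| = |Aut(G)| the pigeonhole principle makes it surjective:
-- every automorphism of G lifts to 𝔫.  Given strict covers c, c′ with
-- isomorphisms α, α′ onto 𝔫, a lift ψ of the automorphism relating the
-- maps induced by α and α′ yields α′⁻¹ ∘ ψ ∘ α : c ≅ c′ fixing G.
module Submission where

open import Defs
open import Relation.Binary.PropositionalEquality
  using (_≡_; refl; sym; trans; cong; cong₂; setoid; module ≡-Reasoning)
open import Data.Nat using (zero; suc; _≤_)
import Data.Nat.Properties as ℕP
open import Data.Fin using (Fin; zero; suc)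
import Data.Fin.Properties as FinP
open import Data.Vec as Vec using (Vec; _∷_; tabulate)
import Data.Vec.Properties as VecP
open import Data.List as List
  using (List; []; _∷_; allFin; concatMap; map; cartesianProductWith)
open import Data.List.Membership.Propositional using (_∈_)
open import Data.List.Membership.Propositional.Properties
  using (∈-allFin; ∈-filter⁺; ∈-filter⁻; ∈-lookup; ∈-cartesianProductWith⁺)
import Data.List.Membership.Setoid.Properties as SetoidMembership
open import Data.List.Relation.Unary.Any as Any using (here)
open import Data.List.Relation.Unary.All as All using ([]; _∷_)
open import Data.List.Relation.Unary.AllPairs using ([]; _∷_)
open import Data.List.Relation.Unary.Unique.Propositional using (Unique)
import Data.List.Relation.Unary.Unique.Propositional.Properties as Unique
open import Data.Product using (Σ; ∃; _,_; proj₁; proj₂)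
open import Data.Empty using (⊥-elim)
open import Function using (_∘_)
open import Function.Definitions using (Injective)
open import Relation.Nullary using (Dec; yes; no; contradiction)

-- Pigeonhole: an injection Fin m → Fin n with n ≤ m is surjective.
-- A value y outside the image would extend f to an injection
-- Fin (1 + m) → Fin n.
injective⇒surjective : ∀ {m n} → n ≤ m → (f : Fin m → Fin n) →
  Injective _≡_ _≡_ f → ∀ y → ∃ λ x → f x ≡ y
injective⇒surjective {m} {n} n≤m f f-inj y
  with FinP.any? (λ x → f x FinP.≟ y)
... | yes hit  = hit
... | no  miss = contradiction (FinP.injective⇒≤ extended-inj) (ℕP.≤⇒≯ n≤m)
  where
  extended : Fin (suc m) → Fin n
  extended zero    = y
  extended (suc x) = f x

  extended-inj : Injective _≡_ _≡_ extended
  extended-inj {zero}  {zero}  _ = refl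
  extended-inj {zero}  {suc x} e = ⊥-elim (miss (x , sym e))
  extended-inj {suc x} {zero}  e = ⊥-elim (miss (x , e))
  extended-inj {suc _} {suc _}  e = cong suc (f-inj e)

unique-lookup-injective : ∀ {A : Set} {xs : List A} → Unique xs →
  ∀ i j → List.lookup xs i ≡ List.lookup xs j → i ≡ j
unique-lookup-injective {xs = _ ∷ _} (_ ∷ _) zero zero _ = refl
unique-lookup-injective {xs = _ ∷ _} (x∉ ∷ _) zero (suc j) e =
  ⊥-elim (All.lookup x∉ (∈-lookup j) e)
unique-lookup-injective {xs = _ ∷ _} (x∉ ∷ _) (suc i) zero e =
  ⊥-elim (All.lookup x∉ (∈-lookup i) (sym e))
unique-lookup-injective {xs = _ ∷ _} (_ ∷ u) (suc i) (suc j) e =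
  cong suc (unique-lookup-injective u i j e)

lookup-extensional : ∀ {A : Set} {k} (u w : Vec A k) →
  (∀ i → Vec.lookup u i ≡ Vec.lookup w i) → u ≡ w
lookup-extensional u w e = begin
  u                       ≡⟨ sym (VecP.tabulate∘lookup u) ⟩
  tabulate (Vec.lookup u) ≡⟨ VecP.tabulate-cong e ⟩
  tabulate (Vec.lookup w) ≡⟨ VecP.tabulate∘lookup w ⟩
  w                       ∎
  where open ≡-Reasoning

tabulate-injective : ∀ {A : Set} {k} (f g : Fin k → A) →
  tabulate f ≡ tabulate g → ∀ x → f x ≡ g x
tabulate-injective f g e x = begin
  f x                        ≡⟨ sym (VecP.lookup∘tabulate f x) ⟩
  Vec.lookup (tabulate f) x  ≡⟨ cong (λ v → Vec.lookup v x) e ⟩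
  Vec.lookup (tabulate g) x  ≡⟨ VecP.lookup∘tabulate g x ⟩
  g x                        ∎
  where open ≡-Reasoning

concatMap-cartesian : ∀ {A B C : Set} (f : A → B → C) (xs : List A) (ys : List B) →
  concatMap (λ a → map (f a) ys) xs ≡ cartesianProductWith f xs ys
concatMap-cartesian f []       ys = refl
concatMap-cartesian f (a ∷ xs) ys = cong (map (f a) ys List.++_) (concatMap-cartesian f xs ys)

allVecs-step : ∀ {A : Set} k (xs : List A) →
  allVecs (suc k) xs ≡ cartesianProductWith _∷_ xs (allVecs k xs)
allVecs-step k xs = concatMap-cartesian _∷_ xs (allVecs k xs)

allVecs-complete : ∀ {A : Set} {xs : List A} → (∀ a → a ∈ xs) →
  ∀ k (v : Vec A k) → v ∈ allVecs k xs
allVecs-complete full zero    Vec.[] = here refl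
allVecs-complete {xs = xs} full (suc k) (a ∷ v)
  rewrite allVecs-step k xs =
    ∈-cartesianProductWith⁺ _∷_ (full a) (allVecs-complete full k v)

allVecs-unique : ∀ {A : Set} {xs : List A} → Unique xs →
  ∀ k → Unique (allVecs k xs)
allVecs-unique u zero = [] ∷ []
allVecs-unique {xs = xs} u (suc k) rewrite allVecs-step k xs =
  Unique.cartesianProductWith⁺ _∷_ VecP.∷-injective u (allVecs-unique u k)

iso⁻¹ : ∀ {g h} → Iso g h → V h → V g
iso⁻¹ f y = proj₁ (iso-surj f y)

iso∘iso⁻¹ : ∀ {g h} (f : Iso g h) y → iso f (iso⁻¹ f y) ≡ y
iso∘iso⁻¹ f y = proj₂ (iso-surj f y)

iso⁻¹∘iso : ∀ {g h} (f : Iso g h) x → iso⁻¹ f (iso f x) ≡ x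
iso⁻¹∘iso f x = iso-inj f _ _ (iso∘iso⁻¹ f (iso f x))

iso-sym : ∀ {g h} → Iso g h → Iso h g
iso-sym {g} {h} f = record
  { iso      = iso⁻¹ f
  ; iso-inj  = λ x y e → begin
      x                  ≡⟨ sym (iso∘iso⁻¹ f x) ⟩
      iso f (iso⁻¹ f x)  ≡⟨ cong (iso f) e ⟩
      iso f (iso⁻¹ f y)  ≡⟨ iso∘iso⁻¹ f y ⟩
      y                  ∎
  ; iso-surj = λ x → iso f x , iso⁻¹∘iso f x
  ; iso-adj  = λ x y → begin
      adj g (iso⁻¹ f x) (iso⁻¹ f y)                  ≡⟨ sym (iso-adj f _ _) ⟩
      adj h (iso f (iso⁻¹ f x)) (iso f (iso⁻¹ f y))  ≡⟨ cong₂ (adj h) (iso∘iso⁻¹ f x) (iso∘iso⁻¹ f y) ⟩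
      adj h x y                                      ∎
  ; iso-fat  = λ x → begin
      fat g (iso⁻¹ f x)          ≡⟨ sym (iso-fat f _) ⟩
      fat h (iso f (iso⁻¹ f x))  ≡⟨ cong (fat h) (iso∘iso⁻¹ f x) ⟩
      fat h x                    ∎
  }
  where open ≡-Reasoning

iso-trans : ∀ {a b c} → Iso a b → Iso b c → Iso a c
iso-trans f g = record
  { iso      = λ x → iso g (iso f x)
  ; iso-inj  = λ x y e → iso-inj f _ _ (iso-inj g _ _ e)
  ; iso-surj = λ z → let (y , gy≡z) = iso-surj g z ; (x , fx≡y) = iso-surj f y
                     in x , trans (cong (iso g) fx≡y) gy≡z
  ; iso-adj  = λ x y → trans (iso-adj g _ _) (iso-adj f x y)
  ; iso-fat  = λ x → trans (iso-fat g _) (iso-fat f x)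
  }

isAut⇒iso : ∀ {h f} → IsAut h f → Iso h h
isAut⇒iso {f = f} (inj , surj , adj-pres , fat-pres) =
  record { iso = f ; iso-inj = inj ; iso-surj = surj ; iso-adj = adj-pres ; iso-fat = fat-pres }

iso⇒isAut : ∀ {h} (f : Iso h h) → IsAut h (iso f)
iso⇒isAut f = iso-inj f , iso-surj f , iso-adj f , iso-fat f

isAut-resp-≗ : ∀ {h f f′} → (∀ x → f x ≡ f′ x) → IsAut h f → IsAut h f′
isAut-resp-≗ {h} e (inj , surj , adj-pres , fat-pres) =
  (λ x y p → inj x y (trans (e x) (trans p (sym (e y))))) ,
  (λ y → proj₁ (surj y) , trans (sym (e _)) (proj₂ (surj y))) ,
  (λ x y → trans (cong₂ (adj h) (sym (e x)) (sym (e y))) (adj-pres x y)) ,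
  (λ x → trans (cong (fat h) (sym (e x))) (fat-pres x))

-- When Aut*(h) is trivial, an automorphism of h is determined by its
-- action on the slim vertices: ψ′⁻¹ ∘ ψ fixes them, hence everything.
autStar-rigid : ∀ {h} → AutStarTrivial h → (ψ ψ′ : Iso h h) →
  (∀ x → Slim h x → iso ψ x ≡ iso ψ′ x) → ∀ x → iso ψ x ≡ iso ψ′ x
autStar-rigid {h} triv ψ ψ′ agree x = begin
  iso ψ x                       ≡⟨ sym (iso∘iso⁻¹ ψ′ (iso ψ x)) ⟩
  iso ψ′ (iso θ x)              ≡⟨ cong (iso ψ′) (triv (iso θ) (iso⇒isAut θ) fixes x) ⟩
  iso ψ′ x                      ∎
  where
  open ≡-Reasoning
  θ = iso-trans ψ (iso-sym ψ′)
  fixes : ∀ u → Slim h u → iso θ u ≡ u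
  fixes u slim = trans (cong (iso⁻¹ ψ′) (agree u slim)) (iso⁻¹∘iso ψ′ u)

-- The enumeration behind |Aut| h: the list of value-vectors of all
-- automorphisms, without repetitions.
module AutEnumeration (h : HoffmanGraph) where

  IsAutVec : (v : Vec (V h) (n h)) → Dec (IsAut h (Vec.lookup v))
  IsAutVec v = isAut? h (Vec.lookup v)

  allMaps : List (Vec (V h) (n h))
  allMaps = allVecs (n h) (allFin (n h))

  autVecs : List (Vec (V h) (n h))
  autVecs = List.filter IsAutVec allMaps

  autVecs-unique : Unique autVecs
  autVecs-unique = Unique.filter⁺ IsAutVec (allVecs-unique (Unique.allFin⁺ (n h)) (n h))

  aut : Fin (|Aut| h) → Iso h h
  aut i = isAut⇒iso (proj₂ (∈-filter⁻ IsAutVec {xs = allMaps} (∈-lookup {xs = autVecs} i)))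

  aut-injective : ∀ i j → (∀ x → iso (aut i) x ≡ iso (aut j) x) → i ≡ j
  aut-injective i j e =
    unique-lookup-injective autVecs-unique i j (lookup-extensional _ _ e)

  tabulate∈autVecs : (σ : Iso h h) → tabulate (iso σ) ∈ autVecs
  tabulate∈autVecs σ = ∈-filter⁺ IsAutVec {xs = allMaps}
    (allVecs-complete ∈-allFin (n h) (tabulate (iso σ)))
    (isAut-resp-≗ {h} (λ x → sym (VecP.lookup∘tabulate (iso σ) x)) (iso⇒isAut σ))

  index : Iso h h → Fin (|Aut| h)
  index σ = Any.index (tabulate∈autVecs σ)

  index-injective : ∀ σ τ → index σ ≡ index τ → ∀ x → iso σ x ≡ iso τ x
  index-injective σ τ e = tabulate-injective (iso σ) (iso τ)
    (SetoidMembership.index-injective (setoid _)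
      (tabulate∈autVecs σ) (tabulate∈autVecs τ) e)

module StrictCoversOf (ℋ : HoffmanGraph → Set) (G : HoffmanGraph) (slimG : IsSlimGraph G) where

  ι : (c : StrictCover ℋ G) → V G → V (cov c)
  ι c = emb (cov-emb c)

  ι-slim : ∀ (c : StrictCover ℋ G) x → Slim (cov c) (ι c x)
  ι-slim c x = trans (emb-fat (cov-emb c) x) (slimG x)

  -- An isomorphism α : c ≅ d maps the copy of G in c onto slim
  -- vertices of d, which by strictness lie in the copy of G in d.
  -- This defines the induced map of G, characterised by induced-spec.
  induced-map : ∀ (c d : StrictCover ℋ G) → Iso (cov c) (cov d) → V G → V G
  induced-map c d α x =
    proj₁ (cov-strict d (iso α (ι c x)) (trans (iso-fat α _) (ι-slim c x)))

  induced-spec : ∀ (c d : StrictCover ℋ G) (α : Iso (cov c) (cov d)) x →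
    ι d (induced-map c d α x) ≡ iso α (ι c x)
  induced-spec c d α x =
    proj₂ (cov-strict d (iso α (ι c x)) (trans (iso-fat α _) (ι-slim c x)))

  -- The map induced by α⁻¹ is a right inverse of the one induced by α.
  induced-surj : ∀ (c d : StrictCover ℋ G) (α : Iso (cov c) (cov d)) y →
    ∃ λ x → induced-map c d α x ≡ y
  induced-surj c d α y = x , emb-inj (cov-emb d) _ _ (begin
    ι d (induced-map c d α x)   ≡⟨ induced-spec c d α x ⟩
    iso α (ι c x)               ≡⟨ cong (iso α) (induced-spec d c (iso-sym α) y) ⟩
    iso α (iso⁻¹ α (ι d y))     ≡⟨ iso∘iso⁻¹ α (ι d y) ⟩
    ι d y                       ∎)
    where
    open ≡-Reasoning
    x = induced-map d c (iso-sym α) y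

  induced : ∀ (c d : StrictCover ℋ G) → Iso (cov c) (cov d) → Iso G G
  induced c d α = record
    { iso      = induced-map c d α
    ; iso-inj  = λ x y e → emb-inj (cov-emb c) _ _ (iso-inj α _ _ (begin
        iso α (ι c x)              ≡⟨ sym (induced-spec c d α x) ⟩
        ι d (induced-map c d α x)  ≡⟨ cong (ι d) e ⟩
        ι d (induced-map c d α y)  ≡⟨ induced-spec c d α y ⟩
        iso α (ι c y)              ∎))
    ; iso-surj = induced-surj c d α
    ; iso-adj  = λ x y → begin
        adj G (induced-map c d α x) (induced-map c d α y)
          ≡⟨ sym (emb-adj (cov-emb d) _ _) ⟩
        adj (cov d) (ι d (induced-map c d α x)) (ι d (induced-map c d α y))
          ≡⟨ cong₂ (adj (cov d)) (induced-spec c d α x) (induced-spec c d α y) ⟩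
        adj (cov d) (iso α (ι c x)) (iso α (ι c y))
          ≡⟨ iso-adj α _ _ ⟩
        adj (cov c) (ι c x) (ι c y)
          ≡⟨ emb-adj (cov-emb c) x y ⟩
        adj G x y ∎
    ; iso-fat  = λ x → trans (slimG _) (sym (slimG x))
    }
    where open ≡-Reasoning

  -- If Aut*(d) is trivial, restriction Aut(d) → Aut(G) is injective:
  -- the slim vertices of d are exactly the copy of G.
  restriction-injective : ∀ (d : StrictCover ℋ G) → AutStarTrivial (cov d) →
    (ψ ψ′ : Iso (cov d) (cov d)) →
    (∀ x → induced-map d d ψ x ≡ induced-map d d ψ′ x) →
    ∀ v → iso ψ v ≡ iso ψ′ v
  restriction-injective d triv ψ ψ′ same = autStar-rigid triv ψ ψ′ agree-on-slim
    where
    agree-on-slim : ∀ u → Slim (cov d) u → iso ψ u ≡ iso ψ′ u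
    agree-on-slim u slim with cov-strict d u slim
    ... | x , refl = begin
      iso ψ (ι d x)               ≡⟨ sym (induced-spec d d ψ x) ⟩
      ι d (induced-map d d ψ x)   ≡⟨ cong (ι d) (same x) ⟩
      ι d (induced-map d d ψ′ x)  ≡⟨ induced-spec d d ψ′ x ⟩
      iso ψ′ (ι d x)              ∎
      where open ≡-Reasoning

  Lift : (d : StrictCover ℋ G) → Iso G G → Set
  Lift d σ = Σ (Iso (cov d) (cov d)) λ ψ → ∀ y → iso ψ (ι d y) ≡ ι d (iso σ y)

  -- If Aut*(d) is trivial and |Aut(d)| = |Aut(G)|, the injective
  -- restriction map between these finite sets is surjective.
  every-automorphism-lifts : ∀ (d : StrictCover ℋ G) → AutStarTrivial (cov d) →
    |Aut| (cov d) ≡ |Aut| G → ∀ σ → Lift d σ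
  every-automorphism-lifts d triv count σ = ψ , ψ-lifts-σ
    where
    module Autᵈ = AutEnumeration (cov d)
    module Autᴳ = AutEnumeration G

    restrict : Fin (|Aut| (cov d)) → Fin (|Aut| G)
    restrict i = Autᴳ.index (induced d d (Autᵈ.aut i))

    restrict-injective : Injective _≡_ _≡_ restrict
    restrict-injective {i} {j} e = Autᵈ.aut-injective i j
      (restriction-injective d triv (Autᵈ.aut i) (Autᵈ.aut j)
        (Autᴳ.index-injective (induced d d (Autᵈ.aut i)) (induced d d (Autᵈ.aut j)) e))

    preimage : ∃ λ i → restrict i ≡ Autᴳ.index σ
    preimage = injective⇒surjective (ℕP.≤-reflexive (sym count))
      restrict restrict-injective (Autᴳ.index σ)

    ψ : Iso (cov d) (cov d)
    ψ = Autᵈ.aut (proj₁ preimage)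

    ψ-lifts-σ : ∀ y → iso ψ (ι d y) ≡ ι d (iso σ y)
    ψ-lifts-σ y = trans (sym (induced-spec d d ψ y))
      (cong (ι d) (Autᴳ.index-injective (induced d d ψ) σ (proj₂ preimage) y))

  -- If every automorphism of G lifts to d, then any two strict covers
  -- isomorphic to d are equivalent: correct α′⁻¹ ∘ α by a lift ψ of the
  -- automorphism τ′ ∘ τ⁻¹ of G relating the maps induced by α and α′.
  equivalent-through : ∀ (d : StrictCover ℋ G) → (∀ σ → Lift d σ) → (c c′ : StrictCover ℋ G) →
    Iso (cov c) (cov d) → Iso (cov c′) (cov d) → Equivalent c c′
  equivalent-through d lifts c c′ α α′ = φ , φ-fixes-G
    where
    τ τ′ : Iso G G
    τ  = induced c d α
    τ′ = induced c′ d α′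

    ψ : Iso (cov d) (cov d)
    ψ = proj₁ (lifts (iso-trans (iso-sym τ) τ′))

    ψ-lifts : ∀ y → iso ψ (ι d y) ≡ ι d (iso τ′ (iso⁻¹ τ y))
    ψ-lifts = proj₂ (lifts (iso-trans (iso-sym τ) τ′))

    φ : Iso (cov c) (cov c′)
    φ = iso-trans α (iso-trans ψ (iso-sym α′))

    φ-fixes-G : ∀ x → iso φ (ι c x) ≡ ι c′ x
    φ-fixes-G x = begin
      iso⁻¹ α′ (iso ψ (iso α (ι c x)))              ≡⟨ cong (iso⁻¹ α′ ∘ iso ψ) (sym (induced-spec c d α x)) ⟩
      iso⁻¹ α′ (iso ψ (ι d (iso τ x)))              ≡⟨ cong (iso⁻¹ α′) (ψ-lifts (iso τ x)) ⟩
      iso⁻¹ α′ (ι d (iso τ′ (iso⁻¹ τ (iso τ x))))   ≡⟨ cong (iso⁻¹ α′ ∘ ι d ∘ iso τ′) (iso⁻¹∘iso τ x) ⟩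
      iso⁻¹ α′ (ι d (iso τ′ x))                     ≡⟨ cong (iso⁻¹ α′) (induced-spec c′ d α′ x) ⟩
      iso⁻¹ α′ (iso α′ (ι c′ x))                    ≡⟨ iso⁻¹∘iso α′ (ι c′ x) ⟩
      ι c′ x                                        ∎
      where open ≡-Reasoning

lemma5p7 : (ℋ : HoffmanGraph → Set) (G : HoffmanGraph) → IsSlimGraph G →
    (𝔫 : StrictCover ℋ G) →
    AutStarTrivial (cov 𝔫) →
    |Aut| (cov 𝔫) ≡ |Aut| G →
    ((c : StrictCover ℋ G) → cov c ≅ cov 𝔫) →
    (c c' : StrictCover ℋ G) → Equivalent c c'
lemma5p7 ℋ G slimG 𝔫 autStar-trivial same-order all-isomorphic c c′ =
  equivalent-through 𝔫 (every-automorphism-lifts 𝔫 autStar-trivial same-order)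
    c c′ (all-isomorphic c) (all-isomorphic c′)
  where open StrictCoversOf ℋ G slimG
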